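{- Let $Y$ be a permutation class and $\pi\in S_n$. Then: (i) For any $1\le i<j\le n$, if the permutation order isomorphic to $\mathrm{mb}(\pi;i,j)$ does not lie in $Y$, then $\pi(i)$ and $\pi(j)$ lie in different $Y$-profile blocks of $\pi$ (for any $Y$-profile decomposition of $\pi$). (ii) Conversely, if $\pi(a_i)$ and $\pi(a_j)$, with $a_i<a_j$, are the first (leftmost) entries of two distinct blocks $\alpha_i$ and $\alpha_j$ of the left-greedy $Y$-profile decomposition of $\pi$, then the permutation order isomorphic to $\mathrm{mb}(\pi;a_i,a_j)$ does not lie in $Y$.
   Context: Permutations of length $n$ are sequences of $1,\dots,n$; $\sigma$ is involved in $\pi$ if some subsequence of $\pi$ is order isomorphic to $\sigma$; a permutation class is a set of permutations closed downward under involvement. An interval (block) of $\pi$ is a segment of consecutive positions whose values form a set of consecutive integers. For $1\le i<j\le n$, $\mathrm{mb}(\pi;i,j)$ is the shortest interval of $\pi$ containing $\pi(i)$ and $\pi(j)$. For $\sigma\in S_m$ and nonempty $\alpha_1,\dots,\alpha_m$, the inflation $\sigma[\alpha_1,\dots,\alpha_m]$ replaces each entry $\sigma(i)$ by an interval order isomorphic to $\alpha_i$, arranged as the entries of $\sigma$. The $Y$-profile $\pi^Y$ is the unique shortest permutation $\pi'$ with $\pi=\pi'[\alpha_1,\dots,\alpha_k]$, all $\alpha_i\in Y$; any such expression with $\pi'=\pi^Y$ is a $Y$-profile decomposition, and the $\alpha_i$ (as sets of entries of $\pi$) are its $Y$-profile blocks. The left-greedy $Y$-profile decomposition is the decomposition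 $\pi=\lambda[\lambda_1,\dots,\lambda_\ell]$, $\lambda_i\in Y$, in which the leftmost block $\lambda_1$ is chosen as long as possible, then $\lambda_2$ as long as possible, and so on; it is a $Y$-profile decomposition. -}

module Defs where

open import Data.Nat using (ℕ; zero; suc; _+_; _∸_; _≤_; _<_; _<ᵇ_)
open import Data.List using (List; []; _∷_; length; map; concat; zip; take; drop; applyUpTo; _++_)
open import Data.List.Relation.Unary.All using (All)
open import Data.List.Relation.Unary.Linked using (Linked)
open import Data.List.Relation.Binary.Permutation.Propositional using (_↭_)
open import Data.Bool using (if_then_else_)
open import Data.Nat.ListAction using (sum)
open import Data.Product using (Σ; _×_; _,_; ∃)
open import Relation.Binary.PropositionalEquality using (_≡_)
open import Relation.Nullary using (¬_)

-- Conventions: sequences are lists of naturals; POSITIONS are 0-based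
-- (position p of the paper's pi is p+1), VALUES of a permutation of
-- length n are 1..n as in the paper.

-- p-th entry of a list (default 0 when out of range; only used in range)
nth : List ℕ → ℕ → ℕ
nth []       _       = 0
nth (x ∷ xs) zero    = x
nth (x ∷ xs) (suc p) = nth xs p

IsPerm : List ℕ → Set
IsPerm xs = xs ↭ applyUpTo suc (length xs)

OrdIso : List ℕ → List ℕ → Set
OrdIso xs ys =
  length xs ≡ length ys ×
  (∀ i j → i < length xs → j < length xs →
     (nth xs i < nth xs j → nth ys i < nth ys j) ×
     (nth ys i < nth ys j → nth xs i < nth xs j))

_≼_ : List ℕ → List ℕ → Set
σ ≼ π = Σ (List ℕ) λ ix →
  Linked _<_ ix × All (λ p → p < length π) ix × OrdIso σ (map (nth π) ix)

PermClass : (List ℕ → Set) → Set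
PermClass Y =
  (∀ π → Y π → IsPerm π) ×
  (∀ π σ → Y π → IsPerm σ → σ ≼ π → Y σ)

seg : List ℕ → ℕ → ℕ → List ℕ
seg π a b = take (suc b ∸ a) (drop a π)

Consecutive : List ℕ → Set
Consecutive xs = ∃ λ m → xs ↭ applyUpTo (m +_) (length xs)

IsInterval : List ℕ → ℕ → ℕ → Set
IsInterval π a b = a ≤ b × b < length π × Consecutive (seg π a b)

IsMB : List ℕ → ℕ → ℕ → ℕ → ℕ → Set
IsMB π i j a b =
  IsInterval π a b × a ≤ i × j ≤ b ×
  (∀ a' b' → IsInterval π a' b' → a' ≤ i → j ≤ b' → b ∸ a ≤ b' ∸ a')

MBNotIn : (List ℕ → Set) → List ℕ → ℕ → ℕ → Set
MBNotIn Y π i j =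
  ∀ a b → IsMB π i j a b → ∀ τ → IsPerm τ → OrdIso τ (seg π a b) → ¬ Y τ

-- inflation σ[α₁,…,αₘ]: block k is αₖ shifted by the total length of the
-- blocks αₗ with σ(l) < σ(k)
inflate : List ℕ → List (List ℕ) → List ℕ
inflate σ αs = concat (map shift (zip σ αs))
  where
  off : ℕ → ℕ
  off s = sum (map (λ { (t , β) → if t <ᵇ s then length β else 0 }) (zip σ αs))
  shift : ℕ × List ℕ → List ℕ
  shift (s , α) = map (_+ off s) α

Decomp : (List ℕ → Set) → List ℕ → List ℕ → List (List ℕ) → Set
Decomp Y π σ αs =
  IsPerm σ × length αs ≡ length σ ×
  All (λ α → Y α × 0 < length α) αs × inflate σ αs ≡ π

ProfileDecomp : (List ℕ → Set) → List ℕ → List ℕ → List (List ℕ) → Set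
ProfileDecomp Y π σ αs =
  Decomp Y π σ αs ×
  (∀ σ' αs' → Decomp Y π σ' αs' → length σ ≤ length σ')

LexGt : List ℕ → List ℕ → Set
LexGt ls' ls = Σ (List ℕ) λ p → Σ ℕ λ x → Σ ℕ λ y →
  Σ (List ℕ) λ r' → Σ (List ℕ) λ r →
  ls' ≡ p ++ (x ∷ r') × ls ≡ p ++ (y ∷ r) × y < x

-- left-greedy decomposition: block lengths (λ₁ as long as possible, then
-- λ₂, …) are lexicographically maximal among all decompositions
LeftGreedy : (List ℕ → Set) → List ℕ → List ℕ → List (List ℕ) → Set
LeftGreedy Y π σ αs =
  Decomp Y π σ αs ×
  (∀ σ' αs' → Decomp Y π σ' αs' → ¬ LexGt (map length αs') (map length αs))

start : List (List ℕ) → ℕ → ℕ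
start αs k = sum (map length (take k αs))

InBlock : List (List ℕ) → ℕ → ℕ → Set
InBlock αs k p = k < length αs × start αs k ≤ p × p < start αs (suc k)

module Submission where

-- (i) If π(i) and π(j) lie in one block β of a decomposition, the intersection of mb(π;i,j)
-- with that block is again an interval containing both entries, so by minimality mb(π;i,j)
-- lies inside the block and its pattern is involved in β ∈ Y.
-- (ii) Let [a,b] = mb(π;aᵢ,aⱼ) have its pattern in Y and let λₖ be the left-greedy block
-- containing a. If λₖ started before a, the part of [a,b] to the right of λₖ would be a
-- shorter interval containing aᵢ and aⱼ. So λₖ starts at a, and replacing the blocks meeting
-- [a,b] by [a,b] itself and the leftover tail of the last of them yields a decomposition
-- whose k-th block is longer than λₖ, contradicting left-greediness.

open import Defs
open import Data.Nat
  using (ℕ; zero; suc; pred; >-nonZero; _+_; _∸_; _≤_; _<_; _<ᵇ_; z≤n; s≤s; s≤s⁻¹; _≤?_; _<?_; _≟_; _⊓_; _⊔_)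
open import Data.Nat.Properties
open import Data.Bool using (true; false; if_then_else_)
open import Data.Nat.ListAction using (sum)
open import Data.List using (List; []; _∷_; length; map; concat; zip; take; drop; applyUpTo; _++_; filter)
open import Data.List.Properties
  using ( length-map; length-++; length-++-sucʳ; length-take; length-drop; length-applyUpTo
        ; filter-notAll; filter-++; filter-all; filter-none; map-∘; map-id-local; map-cong-local
        ; map-++; map-applyUpTo; concat-++; take++drop≡id; drop-drop)
open import Data.List.Relation.Unary.All using (All; []; _∷_)
import Data.List.Relation.Unary.All as All
import Data.List.Relation.Unary.All.Properties as AllP
open import Data.List.Relation.Unary.AllPairs using (AllPairs; []; _∷_)
import Data.List.Relation.Unary.AllPairs as AllPairs
import Data.List.Relation.Unary.AllPairs.Properties as AllPairsP
import Data.List.Relation.Unary.Linked.Properties as Linked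
open import Data.List.Relation.Unary.Any using (here; there)
import Data.List.Relation.Unary.Any as Any
open import Data.List.Membership.Propositional using (_∈_)
open import Data.List.Membership.Propositional.Properties
  using (∈-applyUpTo⁺; ∈-applyUpTo⁻; ∈-map⁺; ∈-map⁻; ∈-concat⁺′; ∈-filter⁺; ∈-filter⁻; ∈-∃++; ∈-++⁻; ∈-++⁺ˡ; ∈-++⁺ʳ)
open import Data.List.Membership.DecPropositional _≟_ using (_∈?_)
open import Data.List.Membership.Propositional.Properties.WithK using (unique∧set⇒bag)
open import Data.List.Relation.Binary.BagAndSetEquality using (∼bag⇒↭)
open import Data.List.Relation.Unary.Unique.Propositional using (Unique)
open import Data.List.Relation.Unary.Unique.Propositional.Properties using (applyUpTo⁺₁; drop⁺; take⁺; filter⁺)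
open import Data.List.Relation.Binary.Permutation.Propositional
  using (_↭_; ↭-sym; ↭-trans; ↭-reflexive; ↭⇒↭ₛ)
open import Data.List.Relation.Binary.Permutation.Propositional.Properties using (∈-resp-↭; ↭-length; map⁺)
open import Data.Product using (Σ; _×_; _,_; ∃; proj₁; proj₂)
open import Data.Sum using (inj₁; inj₂)
open import Data.Empty using (⊥; ⊥-elim)
open import Function.Base using (_∘_; case_of_)
open import Function.Bundles using (mk⇔)
open import Relation.Binary.PropositionalEquality
  using (_≡_; _≢_; refl; sym; trans; cong; cong₂; subst; subst₂; setoid; module ≡-Reasoning)
open import Data.List.Relation.Binary.Permutation.Setoid.Properties (setoid ℕ)
  using (Unique-resp-↭)
open import Relation.Binary.Definitions using (tri<; tri≈; tri>)
open import Relation.Nullary using (¬_; Dec; yes; no)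
open import Relation.Nullary.Reflects using (ofʸ; ofⁿ)
open import Relation.Nullary.Decidable using (_×-dec_; _→-dec_; map′)
open import Relation.Unary using (Decidable)

nth-map : ∀ (f : ℕ → ℕ) xs {i} → i < length xs → nth (map f xs) i ≡ f (nth xs i)
nth-map f (x ∷ xs) {zero}  _   = refl
nth-map f (x ∷ xs) {suc i} i<n = nth-map f xs (s≤s⁻¹ i<n)

nth-++ˡ : ∀ xs ys {i} → i < length xs → nth (xs ++ ys) i ≡ nth xs i
nth-++ˡ (x ∷ xs) ys {zero}  _   = refl
nth-++ˡ (x ∷ xs) ys {suc i} i<n = nth-++ˡ xs ys (s≤s⁻¹ i<n)

nth-drop : ∀ xs a i → nth (drop a xs) i ≡ nth xs (a + i)
nth-drop []       zero    i = refl
nth-drop []       (suc a) i = refl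
nth-drop (x ∷ xs) zero    i = refl
nth-drop (x ∷ xs) (suc a) i = nth-drop xs a i

nth-take : ∀ xs {k i} → i < k → nth (take k xs) i ≡ nth xs i
nth-take []       {suc k} {i}     _   = refl
nth-take (x ∷ xs) {suc k} {zero}  _   = refl
nth-take (x ∷ xs) {suc k} {suc i} i<k = nth-take xs (s≤s⁻¹ i<k)

nth-applyUpTo : ∀ f {n i} → i < n → nth (applyUpTo f n) i ≡ f i
nth-applyUpTo f {suc n} {zero}  _   = refl
nth-applyUpTo f {suc n} {suc i} i<n = nth-applyUpTo (λ i → f (suc i)) (s≤s⁻¹ i<n)

nth-∈ : ∀ xs {p} → p < length xs → nth xs p ∈ xs
nth-∈ (x ∷ xs) {zero}  _   = here refl
nth-∈ (x ∷ xs) {suc p} p<n = there (nth-∈ xs (s≤s⁻¹ p<n))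

∈⇒nth : ∀ {v} xs → v ∈ xs → ∃ λ p → p < length xs × nth xs p ≡ v
∈⇒nth (x ∷ xs) (here refl) = zero , s≤s z≤n , refl
∈⇒nth (x ∷ xs) (there v∈xs) with ∈⇒nth xs v∈xs
... | p , p<n , eq = suc p , s≤s p<n , eq

nth-injective : ∀ {xs} → Unique xs → ∀ {p q} → p < length xs → q < length xs →
                nth xs p ≡ nth xs q → p ≡ q
nth-injective {x ∷ xs} u        {zero}  {zero}  _   _   _  = refl
nth-injective {x ∷ xs} (x∉ ∷ u) {zero}  {suc q} _   q<n eq =
  ⊥-elim (All.lookup x∉ (nth-∈ xs (s≤s⁻¹ q<n)) eq)
nth-injective {x ∷ xs} (x∉ ∷ u) {suc p} {zero}  p<n _   eq =
  ⊥-elim (All.lookup x∉ (nth-∈ xs (s≤s⁻¹ p<n)) (sym eq))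
nth-injective {x ∷ xs} (_ ∷ u)  {suc p} {suc q} p<n q<n eq =
  cong suc (nth-injective u (s≤s⁻¹ p<n) (s≤s⁻¹ q<n) eq)

<∸⇒+≤ : ∀ {a t b} → t < suc b ∸ a → a + t ≤ b
<∸⇒+≤ {zero}          t<   = s≤s⁻¹ t<
<∸⇒+≤ {suc a} {t} {zero}  t< with () ← ≤-trans t< (≤-reflexive (0∸n≡0 a))
<∸⇒+≤ {suc a} {t} {suc b} t< = s≤s (<∸⇒+≤ {a} {t} {b} t<)

+≤⇒<∸ : ∀ {a t b} → a + t ≤ b → t < suc b ∸ a
+≤⇒<∸ {a} {t} {b} a+t≤b =
  subst (t <_) (sym (+-∸-assoc 1 (m+n≤o⇒m≤o a a+t≤b)))
    (s≤s (subst (_≤ b ∸ a) (m+n∸m≡n a t) (∸-monoˡ-≤ a a+t≤b)))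

<∸⇒+< : ∀ {m n i} → i < n ∸ m → m + i < n
<∸⇒+< {m} {n} {i} i<n∸m = subst (m + i <_) (m+[n∸m]≡n m≤n) (+-monoʳ-< m i<n∸m)
  where
  m≤n : m ≤ n
  m≤n = <⇒≤ (m∸n≢0⇒n<m (λ n∸m≡0 → n≮0 (subst (i <_) n∸m≡0 i<n∸m)))

<+⇒∸< : ∀ {s p ℓ} → s ≤ p → p < s + ℓ → p ∸ s < ℓ
<+⇒∸< {s} {p} {ℓ} s≤p p<s+ℓ = subst (p ∸ s <_) (m+n∸m≡n s ℓ) (∸-monoˡ-< p<s+ℓ s≤p)

pred[n]<n : ∀ {n} → 0 < n → pred n < n
pred[n]<n (s≤s _) = ≤-refl

least-witness : ∀ {P : ℕ → Set} → Decidable P → ∀ N → (∃ λ d → d < N × P d) →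
                ∃ λ d → P d × (∀ {d′} → d′ < d → ¬ P d′)
least-witness P? (suc N) (d , d<1+N , Pd) with anyUpTo? P? N
... | yes below = least-witness P? N below
... | no ¬below = d , Pd , λ d′<d Pd′ → ¬below (_ , <-≤-trans d′<d (s≤s⁻¹ d<1+N) , Pd′)

length-seg : ∀ xs a {b} → b < length xs → length (seg xs a b) ≡ suc b ∸ a
length-seg xs a {b} b<n = trans (length-take (suc b ∸ a) (drop a xs))
  (trans (cong ((suc b ∸ a) ⊓_) (length-drop a xs)) (m≤n⇒m⊓n≡m (∸-monoˡ-≤ a b<n)))

nth-seg : ∀ xs {a b t} → t < suc b ∸ a → nth (seg xs a b) t ≡ nth xs (a + t)
nth-seg xs {a} {b} {t} t< = trans (nth-take (drop a xs) t<) (nth-drop xs a t)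

seg-∈⁺ : ∀ xs {a b p} → a ≤ p → p ≤ b → b < length xs → nth xs p ∈ seg xs a b
seg-∈⁺ xs {a} {b} {p} a≤p p≤b b<n =
  subst (_∈ seg xs a b) (trans (nth-seg xs t<) (cong (nth xs) (m+[n∸m]≡n a≤p)))
    (nth-∈ (seg xs a b) (subst (p ∸ a <_) (sym (length-seg xs a b<n)) t<))
  where
  t< : p ∸ a < suc b ∸ a
  t< = +≤⇒<∸ (subst (_≤ b) (sym (m+[n∸m]≡n a≤p)) p≤b)

seg-∈⁻ : ∀ xs {a b v} → b < length xs → v ∈ seg xs a b →
         ∃ λ p → a ≤ p × p ≤ b × nth xs p ≡ v
seg-∈⁻ xs {a} {b} b<n v∈ with ∈⇒nth (seg xs a b) v∈
... | t , t<n , eq = a + t , m≤m+n a t , <∸⇒+≤ {a} t< , trans (sym (nth-seg xs t<)) eq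
  where
  t< : t < suc b ∸ a
  t< = subst (t <_) (length-seg xs a b<n) t<n

0<length-seg : ∀ xs {a b} → a ≤ b → b < length xs → 0 < length (seg xs a b)
0<length-seg xs {a} a≤b b<n =
  subst (0 <_) (sym (length-seg xs a b<n)) (+≤⇒<∸ {a} (≤-trans (≤-reflexive (+-identityʳ a)) a≤b))

drop≡seg++drop : ∀ (xs : List ℕ) {a b} → a ≤ suc b → drop a xs ≡ seg xs a b ++ drop (suc b) xs
drop≡seg++drop xs {a} {b} a≤1+b = begin
  drop a xs                                           ≡⟨ take++drop≡id (suc b ∸ a) (drop a xs) ⟨
  seg xs a b ++ drop (suc b ∸ a) (drop a xs)          ≡⟨ cong (seg xs a b ++_) (drop-drop a (suc b ∸ a) xs) ⟩
  seg xs a b ++ drop (a + (suc b ∸ a)) xs             ≡⟨ cong (λ m → seg xs a b ++ drop m xs) (m+[n∸m]≡n a≤1+b) ⟩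
  seg xs a b ++ drop (suc b) xs                       ∎
  where open ≡-Reasoning

drop-length-++ : ∀ (xs : List ℕ) {ys} m → drop (length xs + m) (xs ++ ys) ≡ drop m ys
drop-length-++ []       m = refl
drop-length-++ (x ∷ xs) m = drop-length-++ xs m

take-length-++ : ∀ (xs : List ℕ) {ys} m → take (length xs + m) (xs ++ ys) ≡ xs ++ take m ys
take-length-++ []       m = refl
take-length-++ (x ∷ xs) m = cong (x ∷_) (take-length-++ xs m)


⊆∧⊇⇒↭ : ∀ {xs ys : List ℕ} → Unique xs → Unique ys →
        (∀ {v} → v ∈ xs → v ∈ ys) → (∀ {v} → v ∈ ys → v ∈ xs) → xs ↭ ys
⊆∧⊇⇒↭ ux uy xs⊆ys ys⊆xs = ∼bag⇒↭ (unique∧set⇒bag ux uy (mk⇔ xs⊆ys ys⊆xs))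

unique-applyUpTo-+ : ∀ m n → Unique (applyUpTo (m +_) n)
unique-applyUpTo-+ m n = applyUpTo⁺₁ (m +_) n (λ i<j _ eq → <⇒≢ i<j (+-cancelˡ-≡ m _ _ eq))

unique-map-local : ∀ {f : ℕ → ℕ} {xs} → (∀ {x y} → x ∈ xs → y ∈ xs → f x ≡ f y → x ≡ y) →
                   Unique xs → Unique (map f xs)
unique-map-local {xs = []}     _   []        = []
unique-map-local {xs = x ∷ xs} inj (x∉ ∷ u) =
  AllP.map⁺ (All.tabulate (λ y∈ fx≡fy → All.lookup x∉ y∈ (inj (here refl) (there y∈) fx≡fy))) ∷
  unique-map-local (λ x∈ y∈ → inj (there x∈) (there y∈)) u

unique-++⁻ : ∀ (xs : List ℕ) {ys} → Unique (xs ++ ys) → Unique ys × (∀ {v} → v ∈ xs → v ∈ ys → ⊥)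
unique-++⁻ []       u        = u , λ ()
unique-++⁻ (x ∷ xs) (x∉ ∷ u) with unique-++⁻ xs u
... | u′ , disjoint = u′ , λ { (here refl) v∈ys → All.lookup x∉ (∈-++⁺ʳ xs v∈ys) refl
                             ; (there v∈xs) v∈ys → disjoint v∈xs v∈ys }

unique⊆⇒length≤ : ∀ {xs ys : List ℕ} → Unique xs → (∀ {v} → v ∈ xs → v ∈ ys) → length xs ≤ length ys
unique⊆⇒length≤ {[]}     _        _     = z≤n
unique⊆⇒length≤ {x ∷ xs} (x∉ ∷ u) xs⊆ys with ∈-∃++ (xs⊆ys (here refl))
... | us , ws , refl = subst (suc (length xs) ≤_) (sym (length-++-sucʳ us x ws)) (s≤s (unique⊆⇒length≤ u xs⊆us++ws))
  where
  xs⊆us++ws : ∀ {v} → v ∈ xs → v ∈ us ++ ws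
  xs⊆us++ws v∈xs with ∈-++⁻ us (xs⊆ys (there v∈xs))
  ... | inj₁ v∈us         = ∈-++⁺ˡ v∈us
  ... | inj₂ (here refl)  = ⊥-elim (All.lookup x∉ v∈xs refl)
  ... | inj₂ (there v∈ws) = ∈-++⁺ʳ us v∈ws

applyUpTo-cong : ∀ {f g : ℕ → ℕ} → (∀ i → f i ≡ g i) → ∀ n → applyUpTo f n ≡ applyUpTo g n
applyUpTo-cong f≗g zero    = refl
applyUpTo-cong f≗g (suc n) = cong₂ _∷_ (f≗g 0) (applyUpTo-cong (λ i → f≗g (suc i)) n)

infix 4 _∈[_,_⟩
_∈[_,_⟩ : ℕ → ℕ → ℕ → Set
v ∈[ M , E ⟩ = M ≤ v × v < E

∈-applyUpTo-+⁺ : ∀ {m n v} → v ∈[ m , m + n ⟩ → v ∈ applyUpTo (m +_) n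
∈-applyUpTo-+⁺ {m} {n} {v} (m≤v , v<m+n) = subst (_∈ applyUpTo (m +_) n) (m+[n∸m]≡n m≤v)
  (∈-applyUpTo⁺ (m +_) (subst (v ∸ m <_) (m+n∸m≡n m n) (∸-monoˡ-< v<m+n m≤v)))

∈-applyUpTo-+⁻ : ∀ {m n v} → v ∈ applyUpTo (m +_) n → v ∈[ m , m + n ⟩
∈-applyUpTo-+⁻ {m} v∈ with ∈-applyUpTo⁻ (m +_) v∈
... | i , i<n , refl = m≤m+n m i , +-monoʳ-< m i<n

consecutive⁺ : ∀ {xs} M E → Unique xs →
  (∀ {v} → v ∈ xs → v ∈[ M , E ⟩) → (∀ {v} → v ∈[ M , E ⟩ → v ∈ xs) → Consecutive xs
consecutive⁺ {xs} M E u xs⊆ ⊆xs =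
  M , subst (λ L → xs ↭ applyUpTo (M +_) L) (sym length-xs) xs↭
  where
  E≡M+[E∸M] : ∀ {v} → v ∈[ M , E ⟩ → E ≡ M + (E ∸ M)
  E≡M+[E∸M] (M≤v , v<E) = sym (m+[n∸m]≡n (≤-trans M≤v (<⇒≤ v<E)))
  xs↭ : xs ↭ applyUpTo (M +_) (E ∸ M)
  xs↭ = ⊆∧⊇⇒↭ u (unique-applyUpTo-+ M (E ∸ M))
    (λ v∈ → let v∈[M,E⟩ = xs⊆ v∈ in
       ∈-applyUpTo-+⁺ (subst (_ ∈[ M ,_⟩) (E≡M+[E∸M] v∈[M,E⟩) v∈[M,E⟩))
    (λ v∈ → let (i , i<E∸M , v≡M+i) = ∈-applyUpTo⁻ (M +_) v∈ in
       subst (_∈ xs) (sym v≡M+i) (⊆xs (m≤m+n M i , <∸⇒+< i<E∸M)))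
  length-xs : length xs ≡ E ∸ M
  length-xs = trans (↭-length xs↭) (length-applyUpTo (M +_) (E ∸ M))

consecutive⁻ : ∀ {xs} → Consecutive xs → ∃ λ m →
  (∀ {v} → v ∈ xs → v ∈[ m , m + length xs ⟩) × (∀ {v} → v ∈[ m , m + length xs ⟩ → v ∈ xs)
consecutive⁻ (m , xs↭) =
  m , (λ v∈ → ∈-applyUpTo-+⁻ (∈-resp-↭ xs↭ v∈)) , (λ v∈ → ∈-resp-↭ (↭-sym xs↭) (∈-applyUpTo-+⁺ v∈))

shifted-perm : ∀ {xs} m → xs ↭ applyUpTo (suc m +_) (length xs) →
               IsPerm (map (_∸ m) xs) × map (_+ m) (map (_∸ m) xs) ≡ xs
shifted-perm {xs} m xs↭ = subst (λ L → map (_∸ m) xs ↭ applyUpTo suc L) (sym (length-map (_∸ m) xs)) xs∸m↭ ,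
  trans (sym (map-∘ xs)) (map-id-local (All.map (m∸n+n≡m ∘ <⇒≤) (All.tabulate m<)))
  where
  m< : ∀ {v} → v ∈ xs → m < v
  m< v∈ = proj₁ (∈-applyUpTo-+⁻ (∈-resp-↭ xs↭ v∈))
  xs∸m↭ : map (_∸ m) xs ↭ applyUpTo suc (length xs)
  xs∸m↭ = ↭-trans (map⁺ (_∸ m) xs↭)
    (↭-reflexive (trans (map-applyUpTo (suc m +_) (_∸ m) (length xs))
      (applyUpTo-cong (λ i → trans (cong (_∸ m) (sym (+-suc m i))) (m+n∸m≡n m (suc i))) (length xs))))


-- Intervals of a permutation

Window : List ℕ → ℕ → ℕ → ℕ → ℕ → Set
Window π a b M E =
  (∀ p → a ≤ p → p ≤ b → nth π p ∈[ M , E ⟩) ×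
  (∀ v → v ∈[ M , E ⟩ → ∃ λ p → a ≤ p × p ≤ b × nth π p ≡ v)

interval⇒window : ∀ π {a b} → IsInterval π a b → ∃ λ M → ∃ λ E → Window π a b M E
interval⇒window π {a} {b} (_ , b<n , consec) with consecutive⁻ consec
... | m , seg⊆ , ⊆seg =
  m , m + length (seg π a b) ,
  (λ p a≤p p≤b → seg⊆ (seg-∈⁺ π a≤p p≤b b<n)) ,
  (λ v v∈ → seg-∈⁻ π b<n (⊆seg v∈))

window⇒interval : ∀ π {a b M E} → Unique π → a ≤ b → b < length π →
                  Window π a b M E → IsInterval π a b
window⇒interval π {a} {b} {M} {E} u a≤b b<n (values , onto) =
  a≤b , b<n , consecutive⁺ M E (take⁺ (suc b ∸ a) (drop⁺ a u))
    (λ v∈ → let (p , a≤p , p≤b , eq) = seg-∈⁻ π b<n v∈ in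
       subst (_∈[ M , E ⟩) eq (values p a≤p p≤b))
    (λ {v} v∈ → let (p , a≤p , p≤b , eq) = onto v v∈ in
       subst (_∈ seg π a b) eq (seg-∈⁺ π a≤p p≤b b<n))

module Perm {π : List ℕ} (P : IsPerm π) where

  n : ℕ
  n = length π

  unique : Unique π
  unique = Unique-resp-↭ (↭⇒↭ₛ (↭-sym P)) (unique-applyUpTo-+ 1 n)

  injective : ∀ {p q} → p < n → q < n → nth π p ≡ nth π q → p ≡ q
  injective = nth-injective unique

  value-range : ∀ {p} → p < n → nth π p ∈[ 1 , suc n ⟩
  value-range p<n = ∈-applyUpTo-+⁻ (∈-resp-↭ P (nth-∈ π p<n))

  onto : ∀ {v} → v ∈[ 1 , suc n ⟩ → ∃ λ p → p < n × nth π p ≡ v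
  onto v∈ = ∈⇒nth π (∈-resp-↭ (↭-sym P) (∈-applyUpTo-+⁺ v∈))

  window-∩ : ∀ {a b M E a′ b′ M′ E′} → b < n → b′ < n →
             Window π a b M E → Window π a′ b′ M′ E′ →
             Window π (a ⊔ a′) (b ⊓ b′) (M ⊔ M′) (E ⊓ E′)
  window-∩ {a} {b} {M} {E} {a′} {b′} {M′} {E′} b<n b′<n (values , onto) (values′ , onto′) =
    (λ p a⊔a′≤p p≤b⊓b′ →
       let (M≤ , <E)   = values  p (m⊔n≤o⇒m≤o a a′ a⊔a′≤p) (m≤n⊓o⇒m≤n b b′ p≤b⊓b′)
           (M′≤ , <E′) = values′ p (m⊔n≤o⇒n≤o a a′ a⊔a′≤p) (m≤n⊓o⇒m≤o b b′ p≤b⊓b′)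
       in ⊔-lub M≤ M′≤ , ⊓-glb <E <E′) ,
    (λ v (M⊔M′≤v , v<E⊓E′) →
       let (p , a≤p , p≤b , eq)      = onto v (m⊔n≤o⇒m≤o M M′ M⊔M′≤v , m<n⊓o⇒m<n E E′ v<E⊓E′)
           (p′ , a′≤p′ , p′≤b′ , eq′) = onto′ v (m⊔n≤o⇒n≤o M M′ M⊔M′≤v , m<n⊓o⇒m<o E E′ v<E⊓E′)
           p≡p′ = injective (≤-<-trans p≤b b<n) (≤-<-trans p′≤b′ b′<n) (trans eq (sym eq′))
       in p , ⊔-lub a≤p (subst (a′ ≤_) (sym p≡p′) a′≤p′) ,
          ⊓-glb p≤b (subst (_≤ b′) (sym p≡p′) p′≤b′) , eq)

  window-∖ : ∀ {a b M E a′ b′ M′ E′ M″ E″} → b < n → a′ ≤ a → a ≤ b′ → b′ < b →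
    Window π a b M E → Window π a′ b′ M′ E′ →
    (∀ {v} → v ∈[ M , E ⟩ → ¬ v ∈[ M′ , E′ ⟩ → v ∈[ M″ , E″ ⟩) →
    (∀ {v} → v ∈[ M″ , E″ ⟩ → v ∈[ M , E ⟩ × ¬ v ∈[ M′ , E′ ⟩) →
    Window π (suc b′) b M″ E″
  window-∖ {a} {b} {a′ = a′} {b′} b<n a′≤a a≤b′ b′<b (values , onto) (values′ , onto′) keep drop =
    (λ p b′<p p≤b →
       keep (values p (≤-trans a≤b′ (<⇒≤ b′<p)) p≤b) (λ v∈Z →
         let (q , _ , q≤b′ , eq) = onto′ _ v∈Z
             q≡p = injective (≤-<-trans q≤b′ (<-trans b′<b b<n)) (≤-<-trans p≤b b<n) eq
         in <⇒≱ b′<p (subst (_≤ b′) q≡p q≤b′))) ,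
    (λ v v∈ →
       let (v∈X , v∉Z) = drop v∈
           (p , a≤p , p≤b , eq) = onto v v∈X
       in case b′ <? p of λ where
            (yes b′<p) → p , b′<p , p≤b , eq
            (no b′≮p)  → ⊥-elim (v∉Z (subst (_∈[ _ , _ ⟩) eq
                                        (values′ p (≤-trans a′≤a a≤p) (≮⇒≥ b′≮p)))))

  -- The value at a′ lies outside [M, E⟩, below or above it; accordingly the positions after b′
  -- carry the values [M ⊔ E′, E⟩, resp. [M, M′ ⊓ E⟩.
  window-∖ˡ : ∀ {a b M E a′ b′ M′ E′} → b < n → a′ < a → a ≤ b′ → b′ < b →
    Window π a b M E → Window π a′ b′ M′ E′ → ∃ λ M″ → ∃ λ E″ → Window π (suc b′) b M″ E″
  window-∖ˡ {a} {b} {M} {E} {a′} {b′} {M′} {E′} b<n a′<a a≤b′ b′<b X@(_ , onto) Z@(values′ , _)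
    with values′ a′ ≤-refl (≤-trans (<⇒≤ a′<a) a≤b′) | nth π a′ <? M | nth π a′ <? E
  ... | M′≤w , _ | yes w<M | _ = M ⊔ E′ , E ,
    window-∖ b<n (<⇒≤ a′<a) a≤b′ b′<b X Z
      (λ (M≤v , v<E) v∉Z → ⊔-lub M≤v (≮⇒≥ (λ v<E′ → v∉Z (≤-trans M′≤w (<⇒≤ (<-≤-trans w<M M≤v)) , v<E′))) , v<E)
      (λ (M⊔E′≤v , v<E) → (m⊔n≤o⇒m≤o M E′ M⊔E′≤v , v<E) , λ (_ , v<E′) → <⇒≱ v<E′ (m⊔n≤o⇒n≤o M E′ M⊔E′≤v))
  ... | _ , w<E′ | no w≮M | no w≮E = M , M′ ⊓ E ,
    window-∖ b<n (<⇒≤ a′<a) a≤b′ b′<b X Z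
      (λ (M≤v , v<E) v∉Z → M≤v , ⊓-glb (≰⇒> (λ M′≤v → v∉Z (M′≤v , <-trans (<-≤-trans v<E (≮⇒≥ w≮E)) w<E′))) v<E)
      (λ (M≤v , v<M′⊓E) → (M≤v , m<n⊓o⇒m<o M′ E v<M′⊓E) , λ (M′≤v , _) → <⇒≱ (m<n⊓o⇒m<n M′ E v<M′⊓E) M′≤v)
  ... | _ | no w≮M | yes w<E with onto _ (≮⇒≥ w≮M , w<E)
  ... | q , a≤q , q≤b , eq = ⊥-elim (<⇒≱ a′<a (subst (a ≤_) q≡a′ a≤q))
    where
    q≡a′ : q ≡ a′
    q≡a′ = injective (≤-<-trans q≤b b<n) (<-trans a′<a (≤-<-trans a≤b′ (<-trans b′<b b<n))) eq

  interval-∖ : ∀ {a b a′ b′} → IsInterval π a b → IsInterval π a′ b′ → a′ < a → a ≤ b′ → b′ < b →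
               IsInterval π (suc b′) b
  interval-∖ X@(_ , b<n , _) Z a′<a a≤b′ b′<b =
    let (_ , _ , WX) = interval⇒window π X
        (_ , _ , WZ) = interval⇒window π Z
    in window⇒interval π unique b′<b b<n (proj₂ (proj₂ (window-∖ˡ b<n a′<a a≤b′ b′<b WX WZ)))

  window-bounds : ∀ {a b M E} → a ≤ b → b < n → Window π a b M E → M ≤ n × E ≤ suc n
  window-bounds {a} {b} {M} {E} a≤b b<n (values , onto) = M≤n , E≤1+n
    where
    M≤n : M ≤ n
    M≤n = ≤-trans (proj₁ (values a ≤-refl a≤b)) (s≤s⁻¹ (proj₂ (value-range (≤-<-trans a≤b b<n))))
    E≤1+n : E ≤ suc n
    E≤1+n with E ≤? suc n
    ... | yes E≤1+n = E≤1+n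
    ... | no E≰1+n with onto (suc n) (≤-trans M≤n (n≤1+n n) , ≰⇒> E≰1+n)
    ... | p , _ , p≤b , eq = ⊥-elim (<-irrefl eq (proj₂ (value-range (≤-<-trans p≤b b<n))))

  window? : ∀ a b M E → Dec (Window π a b M E)
  window? a b M E = map′ from to
    (allUpTo? (λ p → a ≤? p →-dec (M ≤? nth π p ×-dec nth π p <? E)) (suc b) ×-dec
     allUpTo? (λ v → M ≤? v →-dec anyUpTo? (λ p → a ≤? p ×-dec nth π p ≟ v) (suc b)) E)
    where
    BoundedWindow : Set
    BoundedWindow =
      (∀ {p} → p < suc b → a ≤ p → nth π p ∈[ M , E ⟩) ×
      (∀ {v} → v < E → M ≤ v → ∃ λ p → p < suc b × a ≤ p × nth π p ≡ v)
    from : BoundedWindow → Window π a b M E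
    from (values , onto) =
      (λ p a≤p p≤b → values (s≤s p≤b) a≤p) ,
      (λ v (M≤v , v<E) → let (p , p<1+b , a≤p , eq) = onto v<E M≤v in p , a≤p , s≤s⁻¹ p<1+b , eq)
    to : Window π a b M E → BoundedWindow
    to (values , onto) =
      (λ p<1+b a≤p → values _ a≤p (s≤s⁻¹ p<1+b)) ,
      (λ v<E M≤v → let (p , a≤p , p≤b , eq) = onto _ (M≤v , v<E) in p , s≤s p≤b , a≤p , eq)

  interval? : ∀ a b → Dec (IsInterval π a b)
  interval? a b with a ≤? b | b <? n
  ... | no a≰b | _       = no (λ I → a≰b (proj₁ I))
  ... | yes _  | no b≮n  = no (λ I → b≮n (proj₁ (proj₂ I)))
  ... | yes a≤b | yes b<n with anyUpTo? (λ M → anyUpTo? (λ E → window? a b M E) (suc (suc n))) (suc n)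
  ... | yes (M , _ , E , _ , W) = yes (window⇒interval π unique a≤b b<n W)
  ... | no ¬W = no λ I → let (M , E , W) = interval⇒window π I
                             (M≤n , E≤1+n) = window-bounds a≤b b<n W
                         in ¬W (M , s≤s M≤n , E , s≤s E≤1+n , W)

  whole-interval : 0 < n → IsInterval π 0 (pred n)
  whole-interval 0<n = window⇒interval π unique z≤n (pred[n]<n 0<n)
    ((λ p _ p≤pred[n] → value-range (≤-<-trans p≤pred[n] (pred[n]<n 0<n))) ,
     (λ v v∈ → let (p , p<n , eq) = onto v∈ in p , z≤n , <⇒≤pred p<n , eq))

  ∃-mb : ∀ {i j} → i < j → j < n → ∃ λ a → ∃ λ b → IsMB π i j a b
  ∃-mb {i} {j} i<j j<n
    with least-witness covers? n
           (pred n , pred[n]<n 0<n , 0 , s≤s z≤n , <⇒≤pred j<n , whole-interval 0<n)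
    where
    0<n : 0 < n
    0<n = ≤-<-trans z≤n j<n
    Covers : ℕ → Set
    Covers d = ∃ λ a → a < suc i × j ≤ a + d × IsInterval π a (a + d)
    covers? : Decidable Covers
    covers? d = anyUpTo? (λ a → j ≤? a + d ×-dec interval? a (a + d)) (suc i)
  ... | d , (a , a<1+i , j≤a+d , I) , minimal =
    a , a + d , I , s≤s⁻¹ a<1+i , j≤a+d ,
    λ a′ b′ I′ a′≤i j≤b′ →
      let b′≡a′+[b′∸a′] = sym (m+[n∸m]≡n (proj₁ I′)) in
      subst (_≤ b′ ∸ a′) (sym (m+n∸m≡n a d))
        (≮⇒≥ λ b′∸a′<d → minimal b′∸a′<d
          (a′ , s≤s a′≤i , subst (j ≤_) b′≡a′+[b′∸a′] j≤b′ , subst (IsInterval π a′) b′≡a′+[b′∸a′] I′))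

ShiftedPerm : List ℕ → Set
ShiftedPerm xs = ∃ λ c → ∃ λ τ → IsPerm τ × map (_+ c) τ ≡ xs

interval-pattern : ∀ {π a b} → IsPerm π → IsInterval π a b → ShiftedPerm (seg π a b)
interval-pattern {π} {a} {b} P (a≤b , b<n , m , S↭) =
  pred m , map (_∸ pred m) S , shifted-perm (pred m) (subst (λ k → S ↭ applyUpTo (k +_) (length S)) (sym 1+pred[m]≡m) S↭)
  where
  open Perm P using (value-range)
  S : List ℕ
  S = seg π a b
  m∈S : m ∈ S
  m∈S = ∈-resp-↭ (↭-sym S↭) (∈-applyUpTo-+⁺ (≤-refl , m<m+n m (0<length-seg π a≤b b<n)))
  0<m : 0 < m
  0<m = let (p , _ , p≤b , eq) = seg-∈⁻ π {a} b<n m∈S in subst (0 <_) eq (proj₁ (value-range (≤-<-trans p≤b b<n)))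
  1+pred[m]≡m : suc (pred m) ≡ m
  1+pred[m]≡m = suc-pred m {{>-nonZero 0<m}}

no-shorter-subinterval : ∀ {a a′ b′ b} → a ≤ a′ → a′ ≤ b′ → b′ ≤ b → b ∸ a ≤ b′ ∸ a′ → a′ ≤ a × b ≤ b′
no-shorter-subinterval {a} {a′} {b′} {b} a≤a′ a′≤b′ b′≤b length≤ =
  ≮⇒≥ (λ a<a′ → <⇒≱ (<-≤-trans (∸-monoʳ-< a<a′ a′≤b′) (∸-monoˡ-≤ a b′≤b)) length≤) ,
  ≮⇒≥ (λ b′<b → <⇒≱ (<-≤-trans (∸-monoˡ-< b′<b a′≤b′) (∸-monoʳ-≤ b a≤a′)) length≤)


OrdIso-refl : ∀ {xs} → OrdIso xs xs
OrdIso-refl = refl , λ _ _ _ _ → (λ lt → lt) , (λ lt → lt)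

OrdIso-sym : ∀ {xs ys} → OrdIso xs ys → OrdIso ys xs
OrdIso-sym (ℓ≡ , iso) = sym ℓ≡ , λ i j i< j< →
  let (⇒ , ⇐) = iso i j (subst (i <_) (sym ℓ≡) i<) (subst (j <_) (sym ℓ≡) j<) in ⇐ , ⇒

OrdIso-trans : ∀ {xs ys zs} → OrdIso xs ys → OrdIso ys zs → OrdIso xs zs
OrdIso-trans (ℓ≡ , iso) (ℓ≡′ , iso′) = trans ℓ≡ ℓ≡′ , λ i j i< j< →
  let (⇒ , ⇐)   = iso i j i< j<
      (⇒′ , ⇐′) = iso′ i j (subst (i <_) ℓ≡ i<) (subst (j <_) ℓ≡ j<)
  in (λ lt → ⇒′ (⇒ lt)) , (λ lt → ⇐ (⇐′ lt))

OrdIso-shift : ∀ {τ xs ys} c → OrdIso τ xs → length ys ≡ length xs →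
               (∀ {t} → t < length xs → nth xs t ≡ nth ys t + c) → OrdIso τ ys
OrdIso-shift c (ℓ≡ , iso) ℓ≡′ nth≡ = trans ℓ≡ (sym ℓ≡′) , λ i j i< j< →
  let (⇒ , ⇐) = iso i j i< j<
      eqᵢ = nth≡ (subst (i <_) ℓ≡ i<)
      eqⱼ = nth≡ (subst (j <_) ℓ≡ j<)
  in (λ lt → +-cancelʳ-< c _ _ (subst₂ _<_ eqᵢ eqⱼ (⇒ lt))) ,
     (λ lt → ⇐ (subst₂ _<_ (sym eqᵢ) (sym eqⱼ) (+-monoˡ-< c lt)))

OrdIso-map-+ : ∀ β c → OrdIso β (map (_+ c) β)
OrdIso-map-+ β c =
  OrdIso-sym {map (_+ c) β} {β} (OrdIso-shift {β′} {β′} {β} c (OrdIso-refl {β′}) (sym (length-map (_+ c) β))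
  (λ t< → nth-map (_+ c) β (subst (_ <_) (length-map (_+ c) β) t<)))
  where
  β′ : List ℕ
  β′ = map (_+ c) β

nth-select : ∀ γ d {L t} → t < L → nth (map (nth γ) (applyUpTo (d +_) L)) t ≡ nth γ (d + t)
nth-select γ d {L} t<L = trans (nth-map (nth γ) (applyUpTo (d +_) L) (subst (_ <_) (sym (length-applyUpTo (d +_) L)) t<L))
                               (cong (nth γ) (nth-applyUpTo (d +_) t<L))

≼-consecutive : ∀ {τ γ} d L → d + L ≤ length γ → OrdIso τ (map (nth γ) (applyUpTo (d +_) L)) → τ ≼ γ
≼-consecutive {γ = γ} d L d+L≤n iso =
  applyUpTo (d +_) L , Linked.applyUpTo⁺₂ (d +_) L (λ i → +-monoʳ-< d (n<1+n i)) ,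
  All.tabulate (λ p∈ → let (i , i<L , p≡) = ∈-applyUpTo⁻ (d +_) p∈ in
    subst (_< length γ) (sym p≡) (<-≤-trans (+-monoʳ-< d i<L) d+L≤n)) ,
  iso

seg-≼ : ∀ {τ γ d e} → d ≤ e → e < length γ → OrdIso τ (seg γ d e) → τ ≼ γ
seg-≼ {τ} {γ} {d} {e} d≤e e<n iso =
  ≼-consecutive {τ} {γ} d L (subst (_≤ length γ) (sym (m+[n∸m]≡n (m≤n⇒m≤1+n d≤e))) e<n)
    (OrdIso-shift {τ} {seg γ d e} {map (nth γ) (applyUpTo (d +_) L)} 0 iso
      (trans (length-map (nth γ) (applyUpTo (d +_) L)) (trans (length-applyUpTo (d +_) L) (sym (length-seg γ d e<n))))
      (λ t< → let t<L = subst (_ <_) (length-seg γ d e<n) t< in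
         trans (nth-seg γ t<L) (sym (trans (+-identityʳ _) (nth-select γ d t<L)))))
  where
  L : ℕ
  L = suc e ∸ d

OrdIso⇒≼ : ∀ {τ γ} → OrdIso τ γ → τ ≼ γ
OrdIso⇒≼ {τ} {γ} iso =
  ≼-consecutive {τ} {γ} 0 (length γ) ≤-refl
    (OrdIso-shift {τ} {γ} {map (nth γ) (applyUpTo (0 +_) (length γ))} 0 iso
      (trans (length-map (nth γ) (applyUpTo (0 +_) (length γ))) (length-applyUpTo (0 +_) (length γ)))
      (λ t< → sym (trans (+-identityʳ _) (nth-select γ 0 t<))))

same-pattern-∈ : ∀ {Y} → PermClass Y → ∀ {β c xs τ} → IsPerm β → map (_+ c) β ≡ xs →
                 IsPerm τ → OrdIso τ xs → Y τ → Y β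
same-pattern-∈ (_ , closed) {β} {c} {xs} {τ} Pβ shift≡ Pτ isoτ Yτ =
  closed τ β Yτ Pβ (OrdIso⇒≼ {β} {τ} (OrdIso-trans {β} {xs} {τ} (subst (OrdIso β) shift≡ (OrdIso-map-+ β c))
                                                         (OrdIso-sym {τ} {xs} isoτ)))


-- A decomposition σ[α₁,…,αₘ] is handled as the list of its blocks in left-to-right order:
-- block (c , β) stands for the entries of the pattern β raised by the offset c.
Block : Set
Block = ℕ × List ℕ

shift : Block → List ℕ
shift (c , β) = map (_+ c) β

flatten : List Block → List ℕ
flatten bs = concat (map shift bs)

blockStart : List Block → ℕ → ℕ
blockStart bs = start (map proj₂ bs)

length-shift : ∀ b → length (shift b) ≡ length (proj₂ b)
length-shift (c , β) = length-map (_+ c) β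

length-flatten : ∀ bs → length (flatten bs) ≡ blockStart bs (length bs)
length-flatten []       = refl
length-flatten (b ∷ bs) = trans (length-++ (shift b)) (cong₂ _+_ (length-shift b) (length-flatten bs))

drop-blockStart : ∀ bs k → drop (blockStart bs k) (flatten bs) ≡ flatten (drop k bs)
drop-blockStart []       zero    = refl
drop-blockStart []       (suc k) = refl
drop-blockStart (b ∷ bs) zero    = refl
drop-blockStart (b ∷ bs) (suc k) =
  trans (cong (λ l → drop (l + blockStart bs k) (flatten (b ∷ bs))) (sym (length-shift b)))
        (trans (drop-length-++ (shift b) (blockStart bs k)) (drop-blockStart bs k))

take-blockStart : ∀ bs k → take (blockStart bs k) (flatten bs) ≡ flatten (take k bs)
take-blockStart []       zero    = refl
take-blockStart []       (suc k) = refl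
take-blockStart (b ∷ bs) zero    = refl
take-blockStart (b ∷ bs) (suc k) =
  trans (cong (λ l → take (l + blockStart bs k) (flatten (b ∷ bs))) (sym (length-shift b)))
        (trans (take-length-++ (shift b) (blockStart bs k)) (cong (shift b ++_) (take-blockStart bs k)))

blockStart-mono : ∀ bs {k k′} → k ≤ k′ → blockStart bs k ≤ blockStart bs k′
blockStart-mono []       {zero}          _       = z≤n
blockStart-mono []       {suc k} {suc k′} _      = ≤-refl
blockStart-mono (b ∷ bs) {zero}          _       = z≤n
blockStart-mono (b ∷ bs) {suc k} {suc k′} k≤k′   = +-monoʳ-≤ (length (proj₂ b)) (blockStart-mono bs (s≤s⁻¹ k≤k′))

blockStart≤length : ∀ bs {k} → k ≤ length bs → blockStart bs k ≤ length (flatten bs)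
blockStart≤length bs k≤n = ≤-trans (blockStart-mono bs k≤n) (≤-reflexive (sym (length-flatten bs)))

flatten-++ : ∀ bs bs′ → flatten (bs ++ bs′) ≡ flatten bs ++ flatten bs′
flatten-++ bs bs′ = trans (cong concat (map-++ shift bs bs′)) (sym (concat-++ (map shift bs) (map shift bs′)))

record BlockAt (bs : List Block) (k : ℕ) (b : Block) : Set where
  constructor block-at
  field drop≡ : drop k bs ≡ b ∷ drop (suc k) bs

blockAt : ∀ bs {k} → k < length bs → ∃ λ b →
  BlockAt bs k b × b ∈ bs × blockStart bs (suc k) ≡ blockStart bs k + length (proj₂ b)
blockAt (b ∷ bs) {zero}  _   = b , block-at refl , here refl , +-identityʳ _
blockAt (b ∷ bs) {suc k} k<n with blockAt bs (s≤s⁻¹ k<n)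
... | b′ , block-at at , b′∈ , end =
  b′ , block-at at , there b′∈ , trans (cong (length (proj₂ b) +_) end) (sym (+-assoc (length (proj₂ b)) _ _))

blockContaining : ∀ bs {p} → p < blockStart bs (length bs) →
  ∃ λ k → k < length bs × blockStart bs k ≤ p × p < blockStart bs (suc k)
blockContaining ((c , β) ∷ bs) {p} p<n with p <? length β
... | yes p<ℓ = 0 , s≤s z≤n , z≤n , subst (p <_) (sym (+-identityʳ _)) p<ℓ
... | no p≮ℓ with blockContaining bs (subst (p ∸ length β <_) (m+n∸m≡n (length β) _) (∸-monoˡ-< p<n (≮⇒≥ p≮ℓ)))
... | k , k<n , start≤ , <end =
  suc k , s≤s k<n ,
  subst (length β + blockStart bs k ≤_) (m+[n∸m]≡n (≮⇒≥ p≮ℓ)) (+-monoʳ-≤ (length β) start≤) ,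
  subst (_< length β + blockStart bs (suc k)) (m+[n∸m]≡n (≮⇒≥ p≮ℓ)) (+-monoʳ-< (length β) <end)

nth-flatten : ∀ {bs k c β} → BlockAt bs k (c , β) → ∀ {t} → t < length β →
              nth (flatten bs) (blockStart bs k + t) ≡ nth β t + c
nth-flatten {bs} {k} {c} {β} (block-at at) {t} t<ℓ = begin
  nth (flatten bs) (blockStart bs k + t)        ≡⟨ nth-drop (flatten bs) (blockStart bs k) t ⟨
  nth (drop (blockStart bs k) (flatten bs)) t   ≡⟨ cong (λ xs → nth xs t) (drop-blockStart bs k) ⟩
  nth (flatten (drop k bs)) t                   ≡⟨ cong (λ bs′ → nth (flatten bs′) t) at ⟩
  nth (shift (c , β) ++ flatten (drop (suc k) bs)) t
    ≡⟨ nth-++ˡ (shift (c , β)) _ (subst (t <_) (sym (length-map (_+ c) β)) t<ℓ) ⟩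
  nth (map (_+ c) β) t                          ≡⟨ nth-map (_+ c) β t<ℓ ⟩
  nth β t + c                                   ∎
  where open ≡-Reasoning

blockWindow : ∀ {bs k c β e} → IsPerm β → BlockAt bs k (c , β) → suc e ≡ blockStart bs k + length β →
              Window (flatten bs) (blockStart bs k) e (suc c) (suc (length β + c))
blockWindow {bs} {k} {c} {β} {e} Pβ at end = values , onto
  where
  open Perm Pβ using (value-range) renaming (onto to onto-β)
  s : ℕ
  s = blockStart bs k
  values : ∀ p → s ≤ p → p ≤ e → nth (flatten bs) p ∈[ suc c , suc (length β + c) ⟩
  values p s≤p p≤e =
    subst (_∈[ suc c , suc (length β + c) ⟩) (sym nth≡)
      (+-monoˡ-≤ c (proj₁ (value-range t<ℓ)) , +-monoˡ-< c (proj₂ (value-range t<ℓ)))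
    where
    t<ℓ : p ∸ s < length β
    t<ℓ = <+⇒∸< s≤p (subst (p <_) end (s≤s p≤e))
    nth≡ : nth (flatten bs) p ≡ nth β (p ∸ s) + c
    nth≡ = trans (cong (nth (flatten bs)) (sym (m+[n∸m]≡n s≤p))) (nth-flatten at t<ℓ)
  onto : ∀ v → v ∈[ suc c , suc (length β + c) ⟩ → ∃ λ p → s ≤ p × p ≤ e × nth (flatten bs) p ≡ v
  onto v (1+c≤v , v<) with onto-β (m+n≤o⇒m≤o∸n 1 1+c≤v , <+⇒∸< (<⇒≤ 1+c≤v) (subst (v <_) (+-comm (suc (length β)) c) v<))
  ... | t , t<ℓ , nth≡ =
    s + t , m≤m+n s t , s≤s⁻¹ (subst (s + t <_) (sym end) (+-monoʳ-< s t<ℓ)) ,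
    trans (nth-flatten at t<ℓ) (trans (cong (_+ c) nth≡) (m∸n+n≡m (≤-trans (n≤1+n c) 1+c≤v)))

segment-of-block-∈ : ∀ {Y} → PermClass Y → ∀ {bs k c β} → BlockAt bs k (c , β) → Y β →
  ∀ {p q} → blockStart bs k ≤ p → p ≤ q → q < blockStart bs k + length β → q < length (flatten bs) →
  ∀ {τ} → IsPerm τ → OrdIso τ (seg (flatten bs) p q) → Y τ
segment-of-block-∈ {Y} (_ , closed) {bs} {k} {c} {β} at Yβ {p} {q} s≤p p≤q q<end q<n {τ} Pτ iso =
  closed β τ Yβ Pτ (seg-≼ {τ} {β} (∸-monoˡ-≤ s p≤q) e<ℓ
    (OrdIso-shift {τ} {seg π p q} {seg β d e} c iso length≡ nth≡))
  where
  π : List ℕ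
  π = flatten bs
  s d e : ℕ
  s = blockStart bs k
  d = p ∸ s
  e = q ∸ s
  e<ℓ : e < length β
  e<ℓ = <+⇒∸< (≤-trans s≤p p≤q) q<end
  length≡ : length (seg β d e) ≡ length (seg π p q)
  length≡ = begin
    length (seg β d e)   ≡⟨ length-seg β d e<ℓ ⟩
    suc e ∸ d            ≡⟨ [m+n]∸[m+o]≡n∸o s (suc e) d ⟨
    s + suc e ∸ (s + d)  ≡⟨ cong₂ _∸_ (trans (+-suc s e) (cong suc (m+[n∸m]≡n (≤-trans s≤p p≤q)))) (m+[n∸m]≡n s≤p) ⟩
    suc q ∸ p            ≡⟨ length-seg π p q<n ⟨
    length (seg π p q)   ∎
    where open ≡-Reasoning
  nth≡ : ∀ {t} → t < length (seg π p q) → nth (seg π p q) t ≡ nth (seg β d e) t + c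
  nth≡ {t} t< = begin
    nth (seg π p q) t     ≡⟨ nth-seg π t<₁ ⟩
    nth π (p + t)         ≡⟨ cong (nth π) p+t≡s+[d+t] ⟩
    nth π (s + (d + t))   ≡⟨ nth-flatten at (≤-<-trans (<∸⇒+≤ {d} t<₂) e<ℓ) ⟩
    nth β (d + t) + c     ≡⟨ cong (_+ c) (nth-seg β t<₂) ⟨
    nth (seg β d e) t + c ∎
    where
    open ≡-Reasoning
    t<₁ : t < suc q ∸ p
    t<₁ = subst (t <_) (length-seg π p q<n) t<
    t<₂ : t < suc e ∸ d
    t<₂ = subst (t <_) (trans (sym length≡) (length-seg β d e<ℓ)) t<
    p+t≡s+[d+t] : p + t ≡ s + (d + t)
    p+t≡s+[d+t] = trans (cong (_+ t) (sym (m+[n∸m]≡n s≤p))) (+-assoc s d t)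

-- Must agree definitionally with the offset computed inside inflate.
offset : List ℕ → List (List ℕ) → ℕ → ℕ
offset σ αs s = sum (map (λ p → if proj₁ p <ᵇ s then length (proj₂ p) else 0) (zip σ αs))

blocksOf : List ℕ → List (List ℕ) → List Block
blocksOf σ αs = map (λ p → offset σ αs (proj₁ p) , proj₂ p) (zip σ αs)

map-proj₂-zip : ∀ (σ : List ℕ) (αs : List (List ℕ)) → length αs ≡ length σ → map proj₂ (zip σ αs) ≡ αs
map-proj₂-zip []      []       _  = refl
map-proj₂-zip (s ∷ σ) (α ∷ αs) ℓ≡ = cong (α ∷_) (map-proj₂-zip σ αs (suc-injective ℓ≡))

decomp⇒blocks : ∀ {Y π σ αs} → Decomp Y π σ αs → ∃ λ bs → flatten bs ≡ π × map proj₂ bs ≡ αs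
decomp⇒blocks {σ = σ} {αs} (_ , ℓ≡ , _ , inflate≡π) =
  blocksOf σ αs ,
  trans (cong concat (sym (map-∘ (zip σ αs)))) inflate≡π ,
  trans (sym (map-∘ (zip σ αs))) (map-proj₂-zip σ αs ℓ≡)


-- Entries in a common block

mb-within-block : ∀ {bs k c β e} → IsPerm (flatten bs) → IsPerm β → BlockAt bs k (c , β) →
  suc e ≡ blockStart bs k + length β → e < length (flatten bs) →
  ∀ {i j a b} → blockStart bs k ≤ i → i < j → j ≤ e → IsMB (flatten bs) i j a b →
  blockStart bs k ≤ a × b ≤ e
mb-within-block {bs} {k} {e = e} P Pβ at end e<n {i} {j} {a} {b} s≤i i<j j≤e (I@(_ , b<n , _) , a≤i , j≤b , minimal)
  with interval⇒window (flatten bs) I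
... | _ , _ , W = m⊔n≤o⇒n≤o a s (proj₁ shortest) , m≤n⊓o⇒m≤o b e (proj₂ shortest)
  where
  open Perm P using (unique; window-∩)
  s : ℕ
  s = blockStart bs k
  a⊔s≤i : a ⊔ s ≤ i
  a⊔s≤i = ⊔-lub a≤i s≤i
  j≤b⊓e : j ≤ b ⊓ e
  j≤b⊓e = ⊓-glb j≤b j≤e
  a⊔s≤b⊓e : a ⊔ s ≤ b ⊓ e
  a⊔s≤b⊓e = ≤-trans a⊔s≤i (≤-trans (<⇒≤ i<j) j≤b⊓e)
  I∩ : IsInterval (flatten bs) (a ⊔ s) (b ⊓ e)
  I∩ = window⇒interval (flatten bs) unique a⊔s≤b⊓e (≤-<-trans (m⊓n≤m b e) b<n)
         (window-∩ b<n e<n W (blockWindow Pβ at end))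
  shortest : a ⊔ s ≤ a × b ≤ b ⊓ e
  shortest = no-shorter-subinterval (m≤m⊔n a s) a⊔s≤b⊓e (m⊓n≤m b e) (minimal _ _ I∩ a⊔s≤i j≤b⊓e)

same-block⇒mb∈ : ∀ {Y} → PermClass Y → ∀ {bs} → IsPerm (flatten bs) → All (λ b → Y (proj₂ b)) bs →
  ∀ {i j k} → i < j → k < length bs → blockStart bs k ≤ i → j < blockStart bs (suc k) →
  ∀ {a b} → IsMB (flatten bs) i j a b → ∀ {τ} → IsPerm τ → OrdIso τ (seg (flatten bs) a b) → Y τ
same-block⇒mb∈ {Y} PY@(perms , _) {bs} P Ys {i} {j} {k} i<j k<n s≤i j<next mb@((a≤b , b<n , _) , _) Pτ iso
  with blockAt bs k<n
... | (c , β) , at , b∈bs , next≡ =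
  let (s≤a , b≤e) = mb-within-block P (perms β Yβ) at end e<n s≤i i<j (<⇒≤pred j<next) mb
  in segment-of-block-∈ PY at Yβ s≤a a≤b (≤-<-trans b≤e (≤-reflexive end)) b<n Pτ iso
  where
  Yβ : Y β
  Yβ = All.lookup Ys b∈bs
  e : ℕ
  e = pred (blockStart bs (suc k))
  end : suc e ≡ blockStart bs k + length β
  end = trans (suc-pred _ {{>-nonZero (≤-<-trans z≤n j<next)}}) next≡
  e<n : e < length (flatten bs)
  e<n = <-≤-trans (pred[n]<n (≤-<-trans z≤n j<next)) (blockStart≤length bs k<n)

mb∉⇒different-blocks : ∀ {Y} → PermClass Y → ∀ {π} → IsPerm π → ∀ {i j} → i < j → j < length π →
  MBNotIn Y π i j → ∀ {σ αs} → Decomp Y π σ αs → ∀ {k} → InBlock αs k i → InBlock αs k j → ⊥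
mb∉⇒different-blocks PY P i<j j<n mb∉ D@(_ , _ , Yαs , _) (k<n , s≤i , _) (_ , _ , j<next)
  with decomp⇒blocks D
... | bs , refl , refl =
  let (a , b , mb) = Perm.∃-mb P i<j j<n
      (c , τ , Pτ , shift≡) = interval-pattern P (proj₁ mb)
      iso = subst (OrdIso τ) shift≡ (OrdIso-map-+ τ c)
  in mb∉ a b mb τ Pτ iso (same-block⇒mb∈ PY P (All.map proj₁ (AllP.map⁻ Yαs)) i<j
                            (subst (_ <_) (length-map proj₂ bs) k<n) s≤i j<next mb Pτ iso)


-- Reassembling a decomposition from its blocks

<ᵇ-cong : ∀ {m n m′ n′} → (m < n → m′ < n′) → (m′ < n′ → m < n) → (m <ᵇ n) ≡ (m′ <ᵇ n′)
<ᵇ-cong {m} {n} {m′} {n′} ⇒ ⇐ with m <ᵇ n | <ᵇ-reflects-< m n | m′ <ᵇ n′ | <ᵇ-reflects-< m′ n′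
... | false | _       | false | _         = refl
... | true  | _       | true  | _         = refl
... | true  | ofʸ m<n | false | ofⁿ m′≮n′ = ⊥-elim (m′≮n′ (⇒ m<n))
... | false | ofⁿ m≮n | true  | ofʸ m′<n′ = ⊥-elim (m≮n (⇐ m′<n′))

rank : List ℕ → ℕ → ℕ
rank cs c = suc (length (filter (_<? c) cs))

rank-mono-≤ : ∀ cs {c c′} → c ≤ c′ → rank cs c ≤ rank cs c′
rank-mono-≤ []       _    = ≤-refl
rank-mono-≤ (y ∷ cs) {c} {c′} c≤c′ with y <ᵇ c | <ᵇ-reflects-< y c | y <ᵇ c′ | <ᵇ-reflects-< y c′
... | true  | _       | true  | _        = s≤s (rank-mono-≤ cs c≤c′)
... | true  | ofʸ y<c | false | ofⁿ y≮c′ = ⊥-elim (y≮c′ (<-≤-trans y<c c≤c′))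
... | false | _       | true  | _        = m≤n⇒m≤1+n (rank-mono-≤ cs c≤c′)
... | false | _       | false | _        = rank-mono-≤ cs c≤c′

rank-mono-< : ∀ cs {c c′} → c ∈ cs → c < c′ → rank cs c < rank cs c′
rank-mono-< (y ∷ cs) {c} {c′} (here refl) c<c′ with y <ᵇ c | <ᵇ-reflects-< y c | y <ᵇ c′ | <ᵇ-reflects-< y c′
... | true  | ofʸ y<y | _     | _        = ⊥-elim (<-irrefl refl y<y)
... | false | _       | true  | _        = s≤s (rank-mono-≤ cs (<⇒≤ c<c′))
... | false | _       | false | ofⁿ y≮c′ = ⊥-elim (y≮c′ c<c′)
rank-mono-< (y ∷ cs) {c} {c′} (there c∈) c<c′ with y <ᵇ c | <ᵇ-reflects-< y c | y <ᵇ c′ | <ᵇ-reflects-< y c′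
... | true  | _       | true  | _        = s≤s (rank-mono-< cs c∈ c<c′)
... | true  | ofʸ y<c | false | ofⁿ y≮c′ = ⊥-elim (y≮c′ (<-trans y<c c<c′))
... | false | _       | true  | _        = m≤n⇒m≤1+n (rank-mono-< cs c∈ c<c′)
... | false | _       | false | _        = rank-mono-< cs c∈ c<c′

rank-<ᵇ : ∀ cs {c c′} → c ∈ cs → (rank cs c <ᵇ rank cs c′) ≡ (c <ᵇ c′)
rank-<ᵇ cs c∈ = <ᵇ-cong (λ r<r′ → ≰⇒> (λ c′≤c → <⇒≱ r<r′ (rank-mono-≤ cs c′≤c))) (rank-mono-< cs c∈)

rank-injective : ∀ cs {c c′} → c ∈ cs → c′ ∈ cs → rank cs c ≡ rank cs c′ → c ≡ c′
rank-injective cs c∈ c′∈ eq with <-cmp _ _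
... | tri< c<c′ _ _ = ⊥-elim (<⇒≢ (rank-mono-< cs c∈ c<c′) eq)
... | tri≈ _ c≡c′ _ = c≡c′
... | tri> _ _ c′<c = ⊥-elim (<⇒≢ (rank-mono-< cs c′∈ c′<c) (sym eq))

rank-≤-length : ∀ cs {c} → c ∈ cs → rank cs c ≤ length cs
rank-≤-length cs {c} c∈ = filter-notAll (_<? c) cs (Any.map (λ { refl → <-irrefl refl }) c∈)

ranks-perm : ∀ {cs} → Unique cs → IsPerm (map (rank cs) cs)
ranks-perm {cs} u = ⊆∧⊇⇒↭ uσ (unique-applyUpTo-+ 1 r) σ⊆ ⊇σ
  where
  σ : List ℕ
  σ = map (rank cs) cs
  r : ℕ
  r = length σ
  uσ : Unique σ
  uσ = unique-map-local (rank-injective cs) u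
  σ⊆ : ∀ {v} → v ∈ σ → v ∈ applyUpTo suc r
  σ⊆ v∈ with ∈-map⁻ (rank cs) v∈
  ... | c , c∈ , refl = ∈-applyUpTo⁺ suc (subst (rank cs c ≤_) (sym (length-map (rank cs) cs)) (rank-≤-length cs c∈))
  ⊇σ : ∀ {v} → v ∈ applyUpTo suc r → v ∈ σ
  ⊇σ {v} v∈ with v ∈? σ
  ... | yes v∈σ = v∈σ
  ... | no v∉σ  = ⊥-elim (<-irrefl refl (subst (suc r ≤_) (length-applyUpTo suc r)
        (unique⊆⇒length≤ {v ∷ σ} (All.tabulate (λ w∈ v≡w → v∉σ (subst (_∈ σ) (sym v≡w) w∈)) ∷ uσ)
          (λ { (here refl) → v∈ ; (there w∈) → σ⊆ w∈ }))))

ProperBlock : Block → Set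
ProperBlock (c , β) = IsPerm β × 0 < length β

∈-shift⁺ : ∀ {c β v} → IsPerm β → v ∈[ suc c , suc (length β + c) ⟩ → v ∈ shift (c , β)
∈-shift⁺ {c} {β} {v} Pβ (1+c≤v , v<) =
  subst (_∈ shift (c , β)) (m∸n+n≡m (≤-trans (n≤1+n c) 1+c≤v))
    (∈-map⁺ (_+ c) (∈-resp-↭ (↭-sym Pβ)
      (∈-applyUpTo-+⁺ (m+n≤o⇒m≤o∸n 1 1+c≤v , <+⇒∸< (<⇒≤ 1+c≤v) (subst (v <_) (+-comm (suc (length β)) c) v<)))))

∈-shift⁻ : ∀ {c β v} → IsPerm β → v ∈ shift (c , β) → v ∈[ suc c , suc (length β + c) ⟩
∈-shift⁻ {c} {β} Pβ v∈ with ∈-map⁻ (_+ c) v∈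
... | u , u∈β , refl = let (1≤u , u<) = ∈-applyUpTo-+⁻ (∈-resp-↭ Pβ u∈β) in +-monoˡ-≤ c 1≤u , +-monoˡ-< c u<

Apart : Block → Block → Set
Apart (c , β) (c′ , _) = c ≢ c′ × (c < c′ → c + length β ≤ c′)

disjoint⇒apart : ∀ {y z} → ProperBlock y → ProperBlock z →
                 (∀ {v} → v ∈ shift y → v ∈ shift z → ⊥) → Apart y z
disjoint⇒apart {c , β} {c′ , β′} (Pβ , 0<ℓ) (Pβ′ , 0<ℓ′) disjoint =
  (λ { refl → disjoint (∈-shift⁺ Pβ (≤-refl , first∈ 0<ℓ)) (∈-shift⁺ Pβ′ (≤-refl , first∈ 0<ℓ′)) }) ,
  (λ c<c′ → ≮⇒≥ λ c′<c+ℓ → disjoint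
     (∈-shift⁺ Pβ (s≤s (<⇒≤ c<c′) , s≤s (subst (c′ <_) (+-comm c (length β)) c′<c+ℓ)))
     (∈-shift⁺ Pβ′ (≤-refl , first∈ 0<ℓ′)))
  where
  first∈ : ∀ {ℓ d} → 0 < ℓ → suc d < suc (ℓ + d)
  first∈ {ℓ} {d} 0<ℓ = s≤s (+-monoˡ-≤ d 0<ℓ)

apart-pairs : ∀ bs → All ProperBlock bs → Unique (flatten bs) → AllPairs (λ y z → Apart y z × Apart z y) bs
apart-pairs []       []       _ = []
apart-pairs (y ∷ bs) (py ∷ ps) u with unique-++⁻ (shift y) u
... | u′ , disjoint =
  All.tabulate (λ z∈ → disjoint⇒apart py (All.lookup ps z∈) (disjoint′ z∈) ,
                       disjoint⇒apart (All.lookup ps z∈) py (λ v∈z v∈y → disjoint′ z∈ v∈y v∈z)) ∷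
  apart-pairs bs ps u′
  where
  disjoint′ : ∀ {z v} → z ∈ bs → v ∈ shift y → v ∈ shift z → ⊥
  disjoint′ z∈ v∈y v∈z = disjoint v∈y (∈-concat⁺′ v∈z (∈-map⁺ shift z∈))

AllPairs-sym⇒All : ∀ {R : Block → Block → Set} {bs x} → (∀ {y} → R y y) →
                   AllPairs (λ y z → R y z × R z y) bs → x ∈ bs → All (λ y → R y x) bs
AllPairs-sym⇒All R-refl (r ∷ rs) (here refl) = R-refl ∷ All.map proj₂ r
AllPairs-sym⇒All R-refl (r ∷ rs) (there x∈) = proj₁ (All.lookup r x∈) ∷ AllPairs-sym⇒All R-refl rs x∈

count≤ : ℕ → List ℕ → ℕ
count≤ c xs = length (filter (_≤? c) xs)

count≤-concat : ∀ c xss → count≤ c (concat xss) ≡ sum (map (count≤ c) xss)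
count≤-concat c []         = refl
count≤-concat c (xs ∷ xss) =
  trans (cong length (filter-++ (_≤? c) xs (concat xss)))
        (trans (length-++ (filter (_≤? c) xs)) (cong (count≤ c xs +_) (count≤-concat c xss)))

count≤-perm : ∀ {π c} → IsPerm π → c ≤ length π → count≤ c π ≡ c
count≤-perm {π} {c} P c≤n = trans (↭-length filter↭) (length-applyUpTo suc c)
  where
  open Perm P using (unique; value-range; onto)
  filter↭ : filter (_≤? c) π ↭ applyUpTo suc c
  filter↭ = ⊆∧⊇⇒↭ (filter⁺ (_≤? c) unique) (unique-applyUpTo-+ 1 c)
    (λ v∈ → let (v∈π , v≤c) = ∈-filter⁻ (_≤? c) v∈
                (p , p<n , eq) = ∈⇒nth π v∈π
            in ∈-applyUpTo-+⁺ (subst (_ ≤_) eq (proj₁ (value-range p<n)) , s≤s v≤c))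
    (λ v∈ → let (1≤v , v<1+c) = ∈-applyUpTo-+⁻ v∈
                (p , p<n , eq) = onto (1≤v , s≤s (≤-trans (s≤s⁻¹ v<1+c) c≤n))
            in ∈-filter⁺ (_≤? c) (subst (_∈ π) eq (nth-∈ π p<n)) (s≤s⁻¹ v<1+c))

count≤-shift : ∀ {c′ β} c → IsPerm β → (c′ < c → c′ + length β ≤ c) →
               count≤ c (shift (c′ , β)) ≡ (if c′ <ᵇ c then length β else 0)
count≤-shift {c′} {β} c Pβ below with c′ <ᵇ c | <ᵇ-reflects-< c′ c
... | true  | ofʸ c′<c =
  trans (cong length (filter-all (_≤? c) (All.tabulate λ v∈ →
    ≤-trans (s≤s⁻¹ (proj₂ (∈-shift⁻ Pβ v∈))) (subst (_≤ c) (+-comm c′ (length β)) (below c′<c)))))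
    (length-map (_+ c′) β)
... | false | ofⁿ c′≮c =
  cong length (filter-none (_≤? c) (All.tabulate λ v∈ v≤c →
    c′≮c (<-≤-trans (proj₁ (∈-shift⁻ Pβ v∈)) v≤c)))

zip-map : ∀ (f : Block → ℕ) bs → zip (map f bs) (map proj₂ bs) ≡ map (λ y → f y , proj₂ y) bs
zip-map f []       = refl
zip-map f (b ∷ bs) = cong (_ ∷_) (zip-map f bs)

-- The blocks with smaller offset than x supply exactly the values 1..(offset of x) of π.
offset≡length-below : ∀ {bs} → IsPerm (flatten bs) → All ProperBlock bs → ∀ {x} → x ∈ bs →
  sum (map (λ y → if proj₁ y <ᵇ proj₁ x then length (proj₂ y) else 0) bs) ≡ proj₁ x
offset≡length-below {bs} P proper {x} x∈ = begin
  sum (map (λ y → if proj₁ y <ᵇ proj₁ x then length (proj₂ y) else 0) bs)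
    ≡⟨ cong sum (map-cong-local (All.zipWith (λ ((Pβ , _) , below) → count≤-shift (proj₁ x) Pβ below)
                                             (proper , belows))) ⟨
  sum (map (λ y → count≤ (proj₁ x) (shift y)) bs)   ≡⟨ cong sum (map-∘ bs) ⟩
  sum (map (count≤ (proj₁ x)) (map shift bs))       ≡⟨ count≤-concat (proj₁ x) (map shift bs) ⟨
  count≤ (proj₁ x) (flatten bs)                     ≡⟨ count≤-perm P offset≤n ⟩
  proj₁ x                                           ∎
  where
  open ≡-Reasoning
  open Perm P using (unique; value-range)
  belows : All (λ y → proj₁ y < proj₁ x → proj₁ y + length (proj₂ y) ≤ proj₁ x) bs
  belows = AllPairs-sym⇒All (λ c<c → ⊥-elim (<-irrefl refl c<c))
             (AllPairs.map (λ ((_ , r) , (_ , r′)) → r , r′) (apart-pairs bs proper unique)) x∈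
  top∈ : length (proj₂ x) + proj₁ x ∈ flatten bs
  top∈ = let (Pβ , 0<ℓ) = All.lookup proper x∈ in
         ∈-concat⁺′ (∈-shift⁺ Pβ (+-monoˡ-≤ (proj₁ x) 0<ℓ , ≤-refl)) (∈-map⁺ shift x∈)
  offset≤n : proj₁ x ≤ length (flatten bs)
  offset≤n = let (p , p<n , eq) = ∈⇒nth (flatten bs) top∈ in
    ≤-trans (m≤n+m (proj₁ x) (length (proj₂ x))) (subst (_≤ length (flatten bs)) eq (s≤s⁻¹ (proj₂ (value-range p<n))))

blocks⇒decomp : ∀ {Y π bs} → PermClass Y → IsPerm π → flatten bs ≡ π →
  All (λ b → Y (proj₂ b) × 0 < length (proj₂ b)) bs → ∃ λ σ → Decomp Y π σ (map proj₂ bs)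
blocks⇒decomp {Y} {π} {bs} (perms , _) P refl Ybs = σ , Pσ , ℓ≡ , AllP.map⁺ Ybs , inflate≡
  where
  proper : All ProperBlock bs
  proper = All.map (λ (Yβ , 0<ℓ) → perms _ Yβ , 0<ℓ) Ybs
  cs : List ℕ
  cs = map proj₁ bs
  rk : Block → ℕ
  rk b = rank cs (proj₁ b)
  σ : List ℕ
  σ = map rk bs
  αs : List (List ℕ)
  αs = map proj₂ bs
  Pσ : IsPerm σ
  Pσ = subst IsPerm (sym (map-∘ bs))
         (ranks-perm (AllPairsP.map⁺ (AllPairs.map (proj₁ ∘ proj₁) (apart-pairs bs proper (Perm.unique P)))))
  ℓ≡ : length αs ≡ length σ
  ℓ≡ = trans (length-map proj₂ bs) (sym (length-map rk bs))
  offset≡ : ∀ {x} → x ∈ bs → offset σ αs (rk x) ≡ proj₁ x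
  offset≡ {x} x∈ = begin
    offset σ αs (rk x)
      ≡⟨ cong (λ ps → sum (map (λ p → if proj₁ p <ᵇ rk x then length (proj₂ p) else 0) ps)) (zip-map rk bs) ⟩
    sum (map (λ p → if proj₁ p <ᵇ rk x then length (proj₂ p) else 0) (map (λ y → rk y , proj₂ y) bs))
      ≡⟨ cong sum (map-∘ bs) ⟨
    sum (map (λ y → if rk y <ᵇ rk x then length (proj₂ y) else 0) bs)
      ≡⟨ cong sum (map-cong-local (All.tabulate λ {y} y∈ →
           cong (λ b → if b then length (proj₂ y) else 0) (rank-<ᵇ cs (∈-map⁺ proj₁ y∈)))) ⟩
    sum (map (λ y → if proj₁ y <ᵇ proj₁ x then length (proj₂ y) else 0) bs)
      ≡⟨ offset≡length-below P proper x∈ ⟩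
    proj₁ x ∎
    where open ≡-Reasoning
  inflate≡ : inflate σ αs ≡ flatten bs
  inflate≡ = begin
    inflate σ αs
      ≡⟨ cong (λ ps → concat (map (λ p → map (_+ offset σ αs (proj₁ p)) (proj₂ p)) ps)) (zip-map rk bs) ⟩
    concat (map (λ p → map (_+ offset σ αs (proj₁ p)) (proj₂ p)) (map (λ y → rk y , proj₂ y) bs))
      ≡⟨ cong concat (map-∘ bs) ⟨
    concat (map (λ y → map (_+ offset σ αs (rk y)) (proj₂ y)) bs)
      ≡⟨ cong concat (map-cong-local (All.tabulate λ {y} y∈ → cong (λ c → map (_+ c) (proj₂ y)) (offset≡ y∈))) ⟩
    flatten bs ∎
    where open ≡-Reasoning


-- Maximality of left-greedy decompositions

lengths : List Block → List ℕ
lengths bs = map length (map proj₂ bs)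

lengths-++ : ∀ bs bs′ → lengths (bs ++ bs′) ≡ lengths bs ++ lengths bs′
lengths-++ bs bs′ = trans (cong (map length) (map-++ proj₂ bs bs′)) (map-++ length (map proj₂ bs) (map proj₂ bs′))

lengths-lexGt : ∀ {bs k b b′ rs} → BlockAt bs k b → length (proj₂ b) < length (proj₂ b′) →
                LexGt (lengths (take k bs ++ b′ ∷ rs)) (lengths bs)
lengths-lexGt {bs} {k} {b} {b′} {rs} (block-at at) longer =
  lengths (take k bs) , length (proj₂ b′) , length (proj₂ b) , lengths rs , lengths (drop (suc k) bs) ,
  lengths-++ (take k bs) _ ,
  trans (cong lengths (trans (sym (take++drop≡id k bs)) (cong (take k bs ++_) at))) (lengths-++ (take k bs) _) ,
  longer

flatten-replace : ∀ bs {k b c β rs} → map (_+ c) β ≡ seg (flatten bs) (blockStart bs k) b →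
  flatten rs ≡ drop (suc b) (flatten bs) → blockStart bs k ≤ b →
  flatten (take k bs ++ (c , β) ∷ rs) ≡ flatten bs
flatten-replace bs {k} {b} {c} {β} {rs} shift≡ rs≡ s≤b = begin
  flatten (take k bs ++ (c , β) ∷ rs)              ≡⟨ flatten-++ (take k bs) _ ⟩
  flatten (take k bs) ++ map (_+ c) β ++ flatten rs ≡⟨ cong₂ _++_ (sym (take-blockStart bs k)) (cong₂ _++_ shift≡ rs≡) ⟩
  take s π ++ seg π s b ++ drop (suc b) π          ≡⟨ cong (take s π ++_) (drop≡seg++drop π (m≤n⇒m≤1+n s≤b)) ⟨
  take s π ++ drop s π                             ≡⟨ take++drop≡id s π ⟩
  π                                                ∎
  where
  open ≡-Reasoning
  π : List ℕ
  π = flatten bs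
  s : ℕ
  s = blockStart bs k

module Regrouping {Y} (PY : PermClass Y) {bs : List Block} (P : IsPerm (flatten bs))
                  (Ybs : All (λ b → Y (proj₂ b) × 0 < length (proj₂ b)) bs) where

  open Perm P using (unique; interval-∖)

  π : List ℕ
  π = flatten bs

  blockStart-< : ∀ {k} → k < length bs → blockStart bs k < blockStart bs (suc k)
  blockStart-< {k} k<n with blockAt bs k<n
  ... | _ , _ , b∈ , end≡ = subst (blockStart bs k <_) (sym end≡) (m<m+n _ (proj₂ (All.lookup Ybs b∈)))

  lastOf : ℕ → ℕ
  lastOf k = pred (blockStart bs (suc k))

  suc-lastOf : ∀ {k} → k < length bs → suc (lastOf k) ≡ blockStart bs (suc k)
  suc-lastOf k<n = suc-pred _ {{>-nonZero (≤-<-trans z≤n (blockStart-< k<n))}}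

  lastOf<n : ∀ {k} → k < length bs → lastOf k < length π
  lastOf<n k<n = <-≤-trans (≤-reflexive (suc-lastOf k<n)) (blockStart≤length bs k<n)

  blockInterval : ∀ {k} → k < length bs → IsInterval π (blockStart bs k) (lastOf k)
  blockInterval k<n with blockAt bs k<n
  ... | _ , at , b∈ , next≡ =
    window⇒interval π unique (<⇒≤pred (blockStart-< k<n)) (lastOf<n k<n)
      (blockWindow (proj₁ PY _ (proj₁ (All.lookup Ybs b∈))) at (trans (suc-lastOf k<n) next≡))

  block-containing-mb-start : ∀ {x y a b k} → x < y → y < length bs →
    IsMB π (blockStart bs x) (blockStart bs y) a b →
    k < length bs → blockStart bs k ≤ a → a < blockStart bs (suc k) → k ≤ x
  block-containing-mb-start {x} {y} {k = k} x<y y<n (_ , a≤sx , _ , _) k<n sk≤a _ =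
    ≮⇒≥ λ x<k → <⇒≱ (blockStart-< (<-trans x<y y<n)) (≤-trans (blockStart-mono bs x<k) (≤-trans sk≤a a≤sx))

  mb-starts-at-block-start : ∀ {x y a b k} → x < y → y < length bs →
    IsMB π (blockStart bs x) (blockStart bs y) a b →
    k < length bs → blockStart bs k ≤ a → a < blockStart bs (suc k) → blockStart bs k ≡ a
  mb-starts-at-block-start {x} {y} {a} {b} {k} x<y y<n mb@(I@(a≤b , b<n , _) , a≤sx , sy≤b , minimal) k<n sk≤a a<next =
    case blockStart bs k <? a of λ where
      (no sk≮a)  → ≤-antisym sk≤a (≮⇒≥ sk≮a)
      (yes sk<a) → ⊥-elim (<⇒≱ (∸-monoʳ-< a<next′ (next≤b sk<a)) (minimal next b (interval-after sk<a) (next≤sx sk<a) sy≤b))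
    where
    next : ℕ
    next = suc (lastOf k)
    a<next′ : a < next
    a<next′ = subst (a <_) (sym (suc-lastOf k<n)) a<next
    next≤sx : blockStart bs k < a → next ≤ blockStart bs x
    next≤sx sk<a = subst (_≤ blockStart bs x) (sym (suc-lastOf k<n)) (blockStart-mono bs k<x)
      where
      k<x : k < x
      k<x = ≤∧≢⇒< (block-containing-mb-start x<y y<n mb k<n sk≤a a<next)
                   (λ { refl → <⇒≱ sk<a a≤sx })
    next≤b : blockStart bs k < a → next ≤ b
    next≤b sk<a = ≤-trans (next≤sx sk<a) (≤-trans (blockStart-mono bs (<⇒≤ x<y)) sy≤b)
    interval-after : blockStart bs k < a → IsInterval π next b
    interval-after sk<a = interval-∖ I (blockInterval k<n) sk<a (s≤s⁻¹ a<next′) (next≤b sk<a)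

  Admissible : List Block → Set
  Admissible = All (λ b → Y (proj₂ b) × 0 < length (proj₂ b))

  Remainder : ℕ → Set
  Remainder b = ∃ λ rs → flatten rs ≡ drop (suc b) π × Admissible rs

  tail-remainder : ∀ {b l c β} → l < length bs → BlockAt bs l (c , β) → Y β →
    blockStart bs (suc l) ≡ blockStart bs l + length β → blockStart bs l ≤ b → b < lastOf l →
    ShiftedPerm (seg π (suc b) (lastOf l)) → Remainder b
  tail-remainder {b} {l} l<n at Yβ next≡ sl≤b b<last (c₁ , β₁ , Pβ₁ , shift≡) =
    (c₁ , β₁) ∷ drop (suc l) bs ,
    (begin
      map (_+ c₁) β₁ ++ flatten (drop (suc l) bs)        ≡⟨ cong₂ _++_ shift≡ (sym (drop-blockStart bs (suc l))) ⟩
      seg π (suc b) e ++ drop (blockStart bs (suc l)) π ≡⟨ cong (λ m → seg π (suc b) e ++ drop m π) (sym (suc-lastOf l<n)) ⟩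
      seg π (suc b) e ++ drop (suc e) π                 ≡⟨ drop≡seg++drop π (s≤s (<⇒≤ b<last)) ⟨
      drop (suc b) π                                    ∎) ,
    (Yβ₁ , 0<ℓ₁) ∷ AllP.drop⁺ (suc l) Ybs
    where
    open ≡-Reasoning
    e : ℕ
    e = lastOf l
    Yβ₁ : Y β₁
    Yβ₁ = segment-of-block-∈ PY at Yβ (m≤n⇒m≤1+n sl≤b) b<last
            (subst (e <_) next≡ (≤-reflexive (suc-lastOf l<n))) (lastOf<n l<n) Pβ₁
            (subst (OrdIso β₁) shift≡ (OrdIso-map-+ β₁ c₁))
    0<ℓ₁ : 0 < length β₁
    0<ℓ₁ = subst (0 <_) (trans (cong length (sym shift≡)) (length-map (_+ c₁) β₁))
             (0<length-seg π b<last (lastOf<n l<n))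

  remainder : ∀ {a b l} → IsInterval π a b → l < length bs →
    a < blockStart bs l → blockStart bs l ≤ b → b < blockStart bs (suc l) → Remainder b
  remainder {a} {b} {l} I l<n a<sl sl≤b b<next with b <? lastOf l
  ... | no b≮last =
    drop (suc l) bs ,
    trans (sym (drop-blockStart bs (suc l))) (cong (λ m → drop m π) (sym 1+b≡next)) ,
    AllP.drop⁺ (suc l) Ybs
    where
    1+b≡next : suc b ≡ blockStart bs (suc l)
    1+b≡next = ≤-antisym b<next (subst (_≤ suc b) (suc-lastOf l<n) (s≤s (≮⇒≥ b≮last)))
  ... | yes b<last =
    let (_ , at , b∈ , next≡) = blockAt bs l<n in
    tail-remainder l<n at (proj₁ (All.lookup Ybs b∈)) next≡ sl≤b b<last
      (interval-pattern P (interval-∖ (blockInterval l<n) I a<sl sl≤b b<last))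

  replace-blocks : ∀ {a b k} → a ≤ b → b < length π → k < length bs → blockStart bs k ≡ a →
    blockStart bs (suc k) ≤ b → ∀ {c₀ β₀} → map (_+ c₀) β₀ ≡ seg π a b → Y β₀ → Remainder b →
    ∃ λ bs′ → flatten bs′ ≡ π × Admissible bs′ × LexGt (lengths bs′) (lengths bs)
  replace-blocks {a} {b} {k} a≤b b<n k<n sk≡a next≤b {c₀} {β₀} shift≡ Yβ₀ (rs , rs≡ , Yrs) =
    let ((c , β) , at , _ , next≡) = blockAt bs k<n in
    take k bs ++ (c₀ , β₀) ∷ rs ,
    flatten-replace bs {k} (subst (λ m → map (_+ c₀) β₀ ≡ seg π m b) (sym sk≡a) shift≡) rs≡ (subst (_≤ b) (sym sk≡a) a≤b) ,
    AllP.++⁺ (AllP.take⁺ k Ybs) ((Yβ₀ , subst (0 <_) (trans (length-seg π a b<n) (sym length-β₀)) (0<length-seg π a≤b b<n)) ∷ Yrs) ,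
    lengths-lexGt at (subst (length β <_) (sym length-β₀)
                        (+≤⇒<∸ {a} (subst (_≤ b) (trans next≡ (cong (_+ length β) sk≡a)) next≤b)))
    where
    length-β₀ : length β₀ ≡ suc b ∸ a
    length-β₀ = trans (sym (length-map (_+ c₀) β₀)) (trans (cong length shift≡) (length-seg π a b<n))

  regroup : ∀ {a b k} → IsInterval π a b → k < length bs → blockStart bs k ≡ a → blockStart bs (suc k) ≤ b →
    ∀ {τ} → IsPerm τ → OrdIso τ (seg π a b) → Y τ →
    ∃ λ bs′ → flatten bs′ ≡ π × Admissible bs′ × LexGt (lengths bs′) (lengths bs)
  regroup {a} {b} {k} I@(a≤b , b<n , _) k<n sk≡a next≤b {τ} Pτ isoτ Yτ =
    let (c₀ , β₀ , Pβ₀ , shift≡) = interval-pattern P I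
        (l , l<n , sl≤b , b<next) = blockContaining bs (subst (b <_) (length-flatten bs) b<n)
        k<l = ≰⇒> λ l≤k → <⇒≱ b<next (≤-trans (blockStart-mono bs (s≤s l≤k)) next≤b)
        a<sl = subst (_< blockStart bs l) sk≡a (<-≤-trans (blockStart-< k<n) (blockStart-mono bs k<l))
    in replace-blocks a≤b b<n k<n sk≡a next≤b shift≡ (same-pattern-∈ PY Pβ₀ shift≡ Pτ isoτ Yτ)
         (remainder I l<n a<sl sl≤b b<next)

  mb-pattern∉ : ∀ {x y} → x < y → y < length bs →
    (∀ σ′ αs′ → Decomp Y π σ′ αs′ → ¬ LexGt (map length αs′) (lengths bs)) →
    ∀ {a b} → IsMB π (blockStart bs x) (blockStart bs y) a b →
    ∀ {τ} → IsPerm τ → OrdIso τ (seg π a b) → ¬ Y τ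
  mb-pattern∉ {x} {y} x<y y<n maximal {a} {b} mb@(I@(a≤b , b<n , _) , _ , sy≤b , _) Pτ iso Yτ =
    let (k , k<n , sk≤a , a<next) = blockContaining bs (subst (a <_) (length-flatten bs) (≤-<-trans a≤b b<n))
        k≤x = block-containing-mb-start x<y y<n mb k<n sk≤a a<next
        next≤b = ≤-trans (blockStart-mono bs (s≤s k≤x)) (≤-trans (blockStart-mono bs x<y) sy≤b)
        sk≡a = mb-starts-at-block-start x<y y<n mb k<n sk≤a a<next
        (bs′ , flatten≡ , admissible , lex) = regroup I k<n sk≡a next≤b Pτ iso Yτ
        (σ′ , D) = blocks⇒decomp PY P flatten≡ admissible
    in maximal σ′ (map proj₂ bs′) D lex

left-greedy⇒mb∉ : ∀ {Y} → PermClass Y → ∀ {π} → IsPerm π → ∀ {σ αs} → LeftGreedy Y π σ αs →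
  ∀ {i j} → i < j → j < length αs → MBNotIn Y π (start αs i) (start αs j)
left-greedy⇒mb∉ PY P (D@(_ , _ , Yαs , _) , maximal) i<j j<n a b mb τ Pτ iso with decomp⇒blocks D
... | bs , refl , refl =
  Regrouping.mb-pattern∉ PY P (AllP.map⁻ Yαs) i<j (subst (_ <_) (length-map proj₂ bs) j<n) maximal mb Pτ iso


lemma4p2 : (Y : List ℕ → Set) → PermClass Y → (π : List ℕ) → IsPerm π →
    ((i j : ℕ) → i < j → j < length π → MBNotIn Y π i j →
       ∀ σ αs → ProfileDecomp Y π σ αs →
       ¬ (Σ ℕ λ k → InBlock αs k i × InBlock αs k j))
    ×
    (∀ σ αs → LeftGreedy Y π σ αs → (i j : ℕ) → i < j → j < length αs →
       MBNotIn Y π (start αs i) (start αs j))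
lemma4p2 Y PY π P =
  (λ i j i<j j<n mb∉ σ αs (D , _) (k , i∈k , j∈k) → mb∉⇒different-blocks PY P i<j j<n mb∉ D i∈k j∈k) ,
  (λ σ αs G i j i<j j<n → left-greedy⇒mb∉ PY P G i<j j<n)
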